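{- Let $\Phi=\exists_{C_1}s_1\cdots\exists_{C_m}s_m.\,\bigwedge_{1\le i\le n}(\varphi_{path_i}\rightarrow\varphi_i)$ be a CL$_\exists$ formula over coordination variables $\mathcal{C}$ and strategy variables $\mathcal{S}$, where each $\varphi_i$ is an LTL formula and each $\varphi_{path_i}=\mathsf{G}\bigwedge_{(s,c)\in R_i}(c\leftrightarrow s)$ for some $R_i\subseteq\mathcal{S}\times\mathcal{C}$. If there exists a finite counterexample to satisfiability of $\Phi$, then $\Phi$ is unsatisfiable.
   Context: CL$_\exists$. Fix disjoint finite sets $\mathcal{C}$ (coordination variables) and $\mathcal{S}$ (strategy variables). A CL$_\exists$ formula in prenex normal form is $\Phi=\exists_{C_1}s_1\cdots\exists_{C_m}s_m.\,\psi$, where $s_1,\dots,s_m$ enumerate $\mathcal{S}$, each $C_j\subseteq\mathcal{C}$ is the scope $\mathrm{Scope}(s_j)$, and the body $\psi$ is an LTL formula over $\mathcal{C}\cup\mathcal{S}$. A strategy for $s$ is a function $f_s:(2^{\mathrm{Scope}(s)})^*\to 2^{\{s\}}$. For strategies $(f_s)_{s\in\mathcal{S}}$ and $\sigma\in(2^{\mathcal{C}})^\omega$, the induced labeled path is $w\in(2^{\mathcal{C}\cup\mathcal{S}})^\omega$ with $w_t=\sigma_t\cup\bigcup_{s}f_s\big((\sigma_0\cap\mathrm{Scope}(s))\cdots(\sigma_{t-1}\cap\mathrm{Scope}(s))\big)$. $\Phi$ is satisfiable iff there exist strategies such that for every $\sigma\in(2^{\mathcal{C}})^\omega$ the induced labeled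 path satisfies $\psi$ at position $0$. For $\Phi$ as in the claim and each $i$, let $\mathcal{C}^i_{ext}$ be the set of coordination variables $c$ with $(s,c)\notin R_i$ for all $s$ (the external variables of the $i$-th architecture). A word $\sigma'\in(2^{\mathcal{C}})^\omega$ extends $\sigma\in(2^{\mathcal{C}^i_{ext}})^\omega$ if $\sigma'_t\cap\mathcal{C}^i_{ext}=\sigma_t$ for all $t$. A finite counterexample to satisfiability of $\Phi$ consists of $n$ finite sets $\mathcal{P}_i\subseteq(2^{\mathcal{C}^i_{ext}})^\omega$ such that for every choice of strategies $(f_s)_{s\in\mathcal{S}}$ there exist an index $j$, a path $\sigma\in\mathcal{P}_j$ and an extension $\sigma'$ of $\sigma$ whose induced labeled path satisfies $\varphi_{path_j}$ and violates $\varphi_j$. -}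

module Defs where

open import Data.Nat using (ℕ; zero; suc; _≤_; _<_)
open import Data.Fin using (Fin)
open import Data.Bool using (Bool; true; false; _∧_)
open import Data.Sum using (_⊎_; inj₁; inj₂)
open import Data.Product using (Σ; _×_; ∃)
open import Data.Empty using (⊥)
open import Data.Unit using (⊤)
open import Data.List using (List; []; _∷_; _++_; foldr; map; allFin)
open import Data.List.Membership.Propositional using (_∈_)
open import Data.List.Relation.Unary.All using (All)
open import Relation.Nullary using (¬_)
open import Relation.Binary.PropositionalEquality using (_≡_)

Var : ℕ → ℕ → Set
Var nc ns = Fin nc ⊎ Fin ns

data LTL (A : Set) : Set where
  tt    : LTL A
  atom  : A → LTL A
  ¬'    : LTL A → LTL A
  _∧'_  : LTL A → LTL A → LTL A
  X'    : LTL A → LTL A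
  _U'_  : LTL A → LTL A → LTL A

module _ {A : Set} where
  _∨'_ : LTL A → LTL A → LTL A
  φ ∨' ψ = ¬' (¬' φ ∧' ¬' ψ)

  _⇒'_ : LTL A → LTL A → LTL A
  φ ⇒' ψ = ¬' φ ∨' ψ

  _⇔'_ : LTL A → LTL A → LTL A
  φ ⇔' ψ = (φ ⇒' ψ) ∧' (ψ ⇒' φ)

  F' : LTL A → LTL A
  F' φ = tt U' φ

  G' : LTL A → LTL A
  G' φ = ¬' (F' (¬' φ))

  ⋀ : List (LTL A) → LTL A
  ⋀ = foldr _∧'_ tt

  Sat : (ℕ → A → Bool) → ℕ → LTL A → Set
  Sat w i tt        = ⊤
  Sat w i (atom a)  = w i a ≡ true
  Sat w i (¬' φ)    = ¬ Sat w i φ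
  Sat w i (φ ∧' ψ)  = Sat w i φ × Sat w i ψ
  Sat w i (X' φ)    = Sat w (suc i) φ
  Sat w i (φ U' ψ)  = Σ ℕ λ k → (i ≤ k) × Sat w k ψ × (∀ j → i ≤ j → j < k → Sat w j φ)

-- A letter of 2^C as a characteristic function; words are ℕ → letter
Letter : ℕ → Set
Letter nc = Fin nc → Bool

Word : ℕ → Set
Word nc = ℕ → Letter nc

prefix : ∀ {B : Set} → (ℕ → B) → ℕ → List B
prefix σ zero    = []
prefix σ (suc t) = prefix σ t ++ (σ t ∷ [])

_∩_ : ∀ {nc} → Letter nc → (Fin nc → Bool) → Letter nc
(a ∩ X) c = a c ∧ X c

-- Strategy for s: a function from finite sequences of letters (of 2^Scope(s)) to Bool
-- (whether s is set). It is only ever applied to histories masked by Scope(s).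
Strategy : ℕ → Set
Strategy nc = List (Letter nc) → Bool

induced : ∀ {nc ns} → (scope : Fin ns → Fin nc → Bool) → (Fin ns → Strategy nc)
        → Word nc → ℕ → Var nc ns → Bool
induced scope f σ t (inj₁ c) = σ t c
induced scope f σ t (inj₂ s) = f s (map (λ a → a ∩ scope s) (prefix σ t))

Satisfiable : ∀ {nc ns} → (Fin ns → Fin nc → Bool) → LTL (Var nc ns) → Set
Satisfiable {nc} {ns} scope ψ =
  Σ (Fin ns → Strategy nc) λ f → ∀ (σ : Word nc) → Sat (induced scope f σ) 0 ψ

Rel : ℕ → ℕ → Set
Rel nc ns = Fin ns → Fin nc → Bool

pairIff : ∀ {nc ns} → Rel nc ns → Fin ns → Fin nc → LTL (Var nc ns)
pairIff R s c with R s c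
... | true  = atom (inj₁ c) ⇔' atom (inj₂ s)
... | false = tt

pathFormula : ∀ {nc ns} → Rel nc ns → LTL (Var nc ns)
pathFormula {nc} {ns} R =
  G' (⋀ (Data.List.concatMap (λ s → map (pairIff R s) (allFin nc)) (allFin ns)))

body : ∀ {nc ns n} → (Fin n → Rel nc ns) → (Fin n → LTL (Var nc ns)) → LTL (Var nc ns)
body {n = n} R φ = ⋀ (map (λ i → pathFormula (R i) ⇒' φ i) (allFin n))

External : ∀ {nc ns} → Rel nc ns → Fin nc → Set
External R c = ∀ s → R s c ≡ false

OverExt : ∀ {nc ns} → Rel nc ns → Word nc → Set
OverExt R σ = ∀ t c → σ t c ≡ true → External R c

-- σ' extends σ : σ'_t ∩ C_ext = σ_t for all t
Extends : ∀ {nc ns} → Rel nc ns → Word nc → Word nc → Set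
Extends R σ' σ = ∀ t c → (External R c → σ' t c ≡ σ t c) × (¬ External R c → σ t c ≡ false)

FiniteCounterexample : ∀ {nc ns n} → (Fin ns → Fin nc → Bool)
  → (Fin n → Rel nc ns) → (Fin n → LTL (Var nc ns)) → Set
FiniteCounterexample {nc} {ns} {n} scope R φ =
  Σ (Fin n → List (Word nc)) λ P →
    (∀ i → All (OverExt (R i)) (P i)) ×
    (∀ (f : Fin ns → Strategy nc) →
       Σ (Fin n) λ j → Σ (Word nc) λ σ → (σ ∈ P j) × Σ (Word nc) λ σ' →
         Extends (R j) σ' σ ×
         Sat (induced scope f σ') 0 (pathFormula (R j)) ×
         ¬ Sat (induced scope f σ') 0 (φ j))

module Submission where

open import Defs
open import Data.Nat using (ℕ)
open import Data.Fin using (Fin)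
open import Data.Bool using (Bool)
open import Data.Empty using (⊥)
open import Data.List using (List; _∷_; map; allFin)
open import Data.List.Membership.Propositional using (_∈_)
open import Data.List.Membership.Propositional.Properties using (∈-allFin)
open import Data.List.Relation.Unary.Any using (here; there)
open import Data.Product using (_,_)
open import Relation.Nullary using (¬_)
open import Relation.Binary.PropositionalEquality using (refl)

-- Given strategies witnessing satisfiability, the counterexample supplies a word σ'
-- whose induced path satisfies φ_path_j but not φ_j; yet the body holds on every
-- induced path, and it contains the conjunct φ_path_j → φ_j.

module _ {A : Set} (w : ℕ → A → Bool) (i : ℕ) where

  Sat-⋀-map : ∀ {B : Set} (g : B → LTL A) {xs : List B} {x : B}
    → Sat w i (⋀ (map g xs)) → x ∈ xs → Sat w i (g x)
  Sat-⋀-map g (sat-x , _)    (here refl) = sat-x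
  Sat-⋀-map g (_ , sat-rest) (there x∈xs) = Sat-⋀-map g sat-rest x∈xs

  Sat-⇒'-mp : ∀ (φ ψ : LTL A) → Sat w i (φ ⇒' ψ) → Sat w i φ → ¬ Sat w i ψ → ⊥
  Sat-⇒'-mp _ _ sat-φ⇒ψ sat-φ unsat-ψ = sat-φ⇒ψ ((λ unsat-φ → unsat-φ sat-φ) , unsat-ψ)

Sat-body : ∀ {nc ns n} {R : Fin n → Rel nc ns} {φ : Fin n → LTL (Var nc ns)}
  (w : ℕ → Var nc ns → Bool) (i : ℕ) → Sat w i (body R φ)
  → ∀ j → Sat w i (pathFormula (R j) ⇒' φ j)
Sat-body {R = R} {φ} w i sat j =
  Sat-⋀-map w i (λ k → pathFormula (R k) ⇒' φ k) sat (∈-allFin j)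

proposition3p3 : (nc ns n : ℕ) (scope : Fin ns → Fin nc → Bool)
    (R : Fin n → Rel nc ns) (φ : Fin n → LTL (Var nc ns))
    → FiniteCounterexample scope R φ
    → ¬ Satisfiable scope (body R φ)
proposition3p3 nc ns n scope R φ (_ , _ , refute) (f , sat)
  with refute f
... | j , _ , _ , σ' , _ , sat-path , unsat-φ =
  Sat-⇒'-mp w 0 (pathFormula (R j)) (φ j) (Sat-body w 0 (sat σ') j) sat-path unsat-φ
  where w = induced scope f σ'
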